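{- Let $k\ge 2$ and $n\ge 1$. For every $j\in\{1,\dots,k\}$, every $x\in\{1,\dots,k^{n-1}\}$ and every firing strategy, the chip at landing order $(j,x)$ satisfies $c_{(j,x)}\ge jx$.
   Context: The infinite rooted directed $k$-ary tree: every vertex has $k$ children ordered from leftmost (1st) to rightmost ($k$th). Labeled chip-firing: initially chips labeled $1,\dots,k^n$ are on the root; a vertex holding at least $k$ chips may fire by choosing any $k$ of its chips and sending the chip with the $r$-th smallest label to its $r$-th leftmost child ($r=1,\dots,k$); a firing strategy is any sequence of such choices. Exactly $k^{n-1}$ chips arrive at each child of the root. For $j\in\{1,\dots,k\}$ and $1\le x\le k^{n-1}$, $c_{(j,x)}$ denotes, under a given strategy, the $x$-th smallest of the chips that arrive at the $j$-th leftmost child of the root. -}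

module Defs where

open import Data.Nat using (ℕ; zero; suc; _+_; _*_; _∸_; _^_; _≤_; _<_; _≡ᵇ_)
open import Data.Nat.Properties using (≤-decTotalOrder)
open import Data.Bool using (if_then_else_)
open import Data.Fin using (Fin; toℕ; fromℕ<)
import Data.Fin.Properties as FinP
open import Data.List using (List; []; _∷_; length; filter; map; upTo)
import Data.List.Properties as ListP
open import Data.Vec as Vec using (Vec; lookup; allFin)
open import Data.Unit using (⊤)
open import Data.Product using (_×_; Σ)
open import Relation.Binary.PropositionalEquality using (_≡_)
open import Relation.Nullary using (Dec)
open import Data.List.Sort ≤-decTotalOrder using (sort) public

-- A vertex of the infinite k-ary tree, given by the path from the root,
-- written bottom-up: the r-th child of v is  r ∷ v ; the root is  [] .
-- So the j-th child of the root is  j ∷ []  (Fin k index j ↔ (toℕ j + 1)-th leftmost child).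
Vertex : ℕ → Set
Vertex k = List (Fin k)

_≟V_ : ∀ {k} (v w : Vertex k) → Dec (v ≡ w)
_≟V_ = ListP.≡-dec FinP._≟_

-- Positions of the chips: chip with label ℓ sits at vertex (p ℓ).
-- Only labels 1..k^n are meaningful.
Positions : ℕ → Set
Positions k = ℕ → Vertex k

initPos : ∀ {k} → Positions k
initPos _ = []

-- One firing: a vertex and the k chosen chips, listed as a vector
-- (required to be strictly increasing, so entry r is the (r+1)-th smallest label).
record Firing (k : ℕ) : Set where
  constructor firing
  field
    vertex : Vertex k
    chips  : Vec ℕ k
open Firing public

setAt : ∀ {k} → Positions k → ℕ → Vertex k → Positions k
setAt p ℓ w m = if m ≡ᵇ ℓ then w else p m

fire : ∀ {k} → Positions k → Firing k → Positions k
fire {k} p f = Vec.foldr (λ _ → Positions k)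
  (λ r q → setAt q (lookup (chips f) r) (r ∷ vertex f)) p (allFin k)

Legal : (k n : ℕ) → Positions k → Firing k → Set
Legal k n p f =
  ((r s : Fin k) → toℕ r < toℕ s → lookup (chips f) r < lookup (chips f) s) ×
  ((r : Fin k) → 1 ≤ lookup (chips f) r) ×
  ((r : Fin k) → lookup (chips f) r ≤ k ^ n) ×
  ((r : Fin k) → p (lookup (chips f) r) ≡ vertex f)

run : ∀ {k} → Positions k → List (Firing k) → Positions k
run p []       = p
run p (f ∷ fs) = run (fire p f) fs

LegalSeq : (k n : ℕ) → Positions k → List (Firing k) → Set
LegalSeq k n p []       = ⊤
LegalSeq k n p (f ∷ fs) = Legal k n p f × LegalSeq k n (fire p f) fs

labels : ℕ → ℕ → List ℕ
labels k n = map suc (upTo (k ^ n))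

chipsAt : ∀ {k} → ℕ → Positions k → Vertex k → List ℕ
chipsAt {k} n p v = filter (λ ℓ → p ℓ ≟V v) (labels k n)

Stable : (k n : ℕ) → Positions k → Set
Stable k n p = (v : Vertex k) → length (chipsAt n p v) < k

arrivals : ∀ {k} → Fin k → List (Firing k) → List ℕ
arrivals j [] = []
arrivals j (firing [] cs ∷ fs)      = lookup cs j ∷ arrivals j fs
arrivals j (firing (_ ∷ _) _ ∷ fs)  = arrivals j fs

-- sorted list of chips arriving at the j-th child; c_(j,x) is its entry at index x-1
landing : ∀ {k} → Fin k → List (Firing k) → List ℕ
landing j fs = sort (arrivals j fs)

{-# OPTIONS --safe #-}
-- Count the chips with labels in 1..M that sit at the root. No firing moves a chip onto
-- the root, a root firing removes its k chips from it, and any other firing leaves it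
-- alone. All k^n chips start at the root and fewer than k remain there at the end, so
-- there are at least k^(n-1) root firings, each sending one chip to the j-th child:
-- c_(j,x) exists. If c_(j,x) ≤ M := jx - 1, then x root firings sent a chip ≤ M to the
-- j-th child; since a firing hands out its chips in increasing order, each of them also
-- removed from the root the j chips of its first j slots, all ≤ M. That makes jx > M
-- chips with labels in 1..M leaving the root, which is impossible.
module Submission where

open import Defs
open import Data.Nat using (ℕ; suc; _+_; _*_; _∸_; _^_; _≤_; _<_)
open import Data.Fin using (Fin; toℕ; fromℕ<)
open import Data.List using (List; length; lookup)
open import Data.Product using (Σ)

open import Data.Bool using (true; false; T)
open import Data.Unit using (tt)
open import Data.Nat using (zero; z≤n; s≤s; s≤s⁻¹; pred; _≡ᵇ_)
open import Data.Nat.Properties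
import Data.Fin as Fin
import Data.Fin.Properties as Fin
open import Data.List using ([]; _∷_; _++_; [_]; map; upTo; filter)
open import Data.List.Properties using (map-++; upTo-∷ʳ; length-++; filter-++; filter-accept; filter-reject)
open import Data.List.Relation.Unary.Sorted.TotalOrder ≤-totalOrder using (Sorted)
import Data.List.Relation.Unary.Linked as Linked
open import Data.List.Relation.Unary.Sorted.TotalOrder.Properties using (lookup-mono-≤)
open import Data.List.Relation.Binary.Permutation.Propositional.Properties using (↭-length; filter-↭)
open import Data.List.Sort ≤-decTotalOrder using (sort-↭; sort-↗)
open import Data.Product using (∃-syntax; _×_; _,_)
open import Data.Sum using (_⊎_; inj₁; inj₂)
open import Data.Vec as Vec using (Vec; allFin)
open import Data.Vec.Membership.Propositional using (_∈_)
open import Data.Vec.Membership.Propositional.Properties using (∈-allFin⁺)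
open import Data.Vec.Relation.Unary.Any using (here; there)
open import Function using (_∘_)
open import Relation.Nullary using (Dec; yes; no; contradiction)
open import Relation.Binary.PropositionalEquality
  using (_≡_; _≢_; refl; sym; trans; cong; cong₂; subst; subst₂; module ≡-Reasoning)

sumTo : ℕ → (ℕ → ℕ) → ℕ
sumTo zero    g = 0
sumTo (suc M) g = sumTo M g + g (suc M)

sumTo-mono-≤ : ∀ {g h} M → (∀ ℓ → ℓ ≤ M → g ℓ ≤ h ℓ) → sumTo M g ≤ sumTo M h
sumTo-mono-≤ zero    g≤h = z≤n
sumTo-mono-≤ (suc M) g≤h =
  +-mono-≤ (sumTo-mono-≤ M (λ ℓ ℓ≤M → g≤h ℓ (m≤n⇒m≤1+n ℓ≤M))) (g≤h (suc M) ≤-refl)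

sumTo-≤-except : ∀ {g h} M a → (∀ ℓ → ℓ ≢ a → g ℓ ≤ h ℓ) → g a ≤ suc (h a) →
  sumTo M g ≤ suc (sumTo M h)
sumTo-≤-except zero    a g≤h ga≤ = z≤n
sumTo-≤-except {g} {h} (suc M) a g≤h ga≤ with suc M ≟ a
... | yes refl = ≤-trans (+-mono-≤ below ga≤) (≤-reflexive (+-suc _ _))
  where
  below : sumTo M g ≤ sumTo M h
  below = sumTo-mono-≤ M (λ ℓ ℓ≤M → g≤h ℓ (λ { refl → 1+n≰n ℓ≤M }))
... | no 1+M≢a = +-mono-≤ (sumTo-≤-except M a g≤h ga≤) (g≤h (suc M) 1+M≢a)

sumTo-gap : ∀ {k g h} (a : Fin k → ℕ) →
  (∀ r s → toℕ r < toℕ s → a r < a s) → (∀ r → 1 ≤ a r) →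
  (∀ ℓ → h ℓ ≤ g ℓ) → (∀ r → h (a r) < g (a r)) →
  ∀ M r → a r ≤ M → suc (toℕ r) + sumTo M h ≤ sumTo M g
sumTo-gap a a↑ a≥1 h≤g h<g zero r ar≤0 with () ← ≤-trans (a≥1 r) ar≤0
sumTo-gap {g = g} {h} a a↑ a≥1 h≤g h<g (suc M) r ar≤1+M with m≤n⇒m<n∨m≡n ar≤1+M
... | inj₁ ar≤M =
  subst (_≤ sumTo (suc M) g) (+-assoc (suc (toℕ r)) _ _)
    (+-mono-≤ (sumTo-gap a a↑ a≥1 h≤g h<g M r (s≤s⁻¹ ar≤M)) (h≤g (suc M)))
... | inj₂ ar≡1+M =
  subst (_≤ sumTo (suc M) g) (trans (+-suc _ _) (cong suc (+-assoc (toℕ r) _ _)))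
    (+-mono-≤ (earlier r ar≡1+M) (subst (λ ℓ → h ℓ < g ℓ) ar≡1+M (h<g r)))
  where
  earlier : ∀ r → a r ≡ suc M → toℕ r + sumTo M h ≤ sumTo M g
  earlier Fin.zero    _      = sumTo-mono-≤ M (λ ℓ _ → h≤g ℓ)
  earlier (Fin.suc r) ar≡1+M =
    subst (λ t → suc t + _ ≤ _) (Fin.toℕ-inject₁ r)
      (sumTo-gap a a↑ a≥1 h≤g h<g M (Fin.inject₁ r)
        (s≤s⁻¹ (subst (a (Fin.inject₁ r) <_) ar≡1+M
          (a↑ _ _ (s≤s (≤-reflexive (Fin.toℕ-inject₁ r)))))))

atRoot : ∀ {k} → Vertex k → ℕ
atRoot []      = 1
atRoot (_ ∷ _) = 0

atRoot≤1 : ∀ {k} (v : Vertex k) → atRoot v ≤ 1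
atRoot≤1 []      = ≤-refl
atRoot≤1 (_ ∷ _) = z≤n

rootCount : ∀ {k} → Positions k → ℕ → ℕ
rootCount p M = sumTo M (λ ℓ → atRoot (p ℓ))

rootCount-initPos : ∀ {k} M → rootCount (initPos {k}) M ≡ M
rootCount-initPos zero    = refl
rootCount-initPos {k} (suc M) = trans (cong (_+ 1) (rootCount-initPos {k} M)) (+-comm M 1)

length-filter-atRoot : ∀ {k} (p : Positions k) M →
  length (filter (λ ℓ → p ℓ ≟V []) (map suc (upTo M))) ≡ rootCount p M
length-filter-atRoot p zero    = refl
length-filter-atRoot p (suc M) = begin
  length (filter P? (map suc (upTo (suc M))))
    ≡⟨ cong (length ∘ filter P?) (trans (cong (map suc) (sym (upTo-∷ʳ M))) (map-++ suc (upTo M) [ M ])) ⟩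
  length (filter P? (map suc (upTo M) ++ [ suc M ]))
    ≡⟨ cong length (filter-++ P? (map suc (upTo M)) [ suc M ]) ⟩
  length (filter P? (map suc (upTo M)) ++ filter P? [ suc M ])
    ≡⟨ length-++ (filter P? (map suc (upTo M))) ⟩
  length (filter P? (map suc (upTo M))) + length (filter P? [ suc M ])
    ≡⟨ cong₂ _+_ (length-filter-atRoot p M) (singleton (suc M)) ⟩
  rootCount p (suc M) ∎
  where
  open ≡-Reasoning
  P? : ∀ ℓ → Dec (p ℓ ≡ [])
  P? ℓ = p ℓ ≟V []
  singleton : ∀ ℓ → length (filter P? [ ℓ ]) ≡ atRoot (p ℓ)
  singleton ℓ with p ℓ
  ... | []    = refl
  ... | _ ∷ _ = refl

rootCount-stable : ∀ {k n} {p : Positions k} → Stable k n p → rootCount p (k ^ n) < k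
rootCount-stable {k} {n} {p} stable = subst (_< k) (length-filter-atRoot p (k ^ n)) (stable [])

rootCount-≤-setAt : ∀ {k} (p : Positions k) a w M → rootCount p M ≤ suc (rootCount (setAt p a w) M)
rootCount-≤-setAt p a w M = sumTo-≤-except M a unchanged (≤-trans (atRoot≤1 (p a)) (s≤s z≤n))
  where
  unchanged : ∀ ℓ → ℓ ≢ a → atRoot (p ℓ) ≤ atRoot (setAt p a w ℓ)
  unchanged ℓ ℓ≢a with ℓ ≡ᵇ a in ℓ≡ᵇa
  ... | true  = contradiction (≡ᵇ⇒≡ ℓ a (subst T (sym ℓ≡ᵇa) tt)) ℓ≢a
  ... | false = ≤-refl

fireAlong : ∀ {k m} → Positions k → Firing k → Vec (Fin k) m → Positions k
fireAlong {k} p f = Vec.foldr (λ _ → Positions k) (λ r q → setAt q (Vec.lookup (chips f) r) (r ∷ vertex f)) p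

fire-cases : ∀ {k} (p : Positions k) f ℓ →
  fire p f ℓ ≡ p ℓ ⊎ ∃[ r ] (ℓ ≡ Vec.lookup (chips f) r × fire p f ℓ ≡ r ∷ vertex f)
fire-cases {k} p f ℓ = go (allFin k)
  where
  go : ∀ {m} (rs : Vec (Fin k) m) →
    fireAlong p f rs ℓ ≡ p ℓ ⊎ ∃[ r ] (ℓ ≡ Vec.lookup (chips f) r × fireAlong p f rs ℓ ≡ r ∷ vertex f)
  go Vec.[] = inj₁ refl
  go (r Vec.∷ rs) with ℓ ≡ᵇ Vec.lookup (chips f) r in ℓ≡ᵇcᵣ
  ... | true  = inj₂ (r , ≡ᵇ⇒≡ ℓ _ (subst T (sym ℓ≡ᵇcᵣ) tt) , refl)
  ... | false = go rs

fire-chosen : ∀ {k} (p : Positions k) f r → ∃[ r′ ] fire p f (Vec.lookup (chips f) r) ≡ r′ ∷ vertex f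
fire-chosen {k} p f r = go (allFin k) (∈-allFin⁺ r)
  where
  cᵣ : ℕ
  cᵣ = Vec.lookup (chips f) r
  go : ∀ {m} (rs : Vec (Fin k) m) → r ∈ rs → ∃[ r′ ] fireAlong p f rs cᵣ ≡ r′ ∷ vertex f
  go (s Vec.∷ rs) r∈ with cᵣ ≡ᵇ Vec.lookup (chips f) s in cᵣ≡ᵇcₛ
  go (s Vec.∷ rs) r∈          | true  = s , refl
  go (s Vec.∷ rs) (here refl) | false = contradiction (subst T cᵣ≡ᵇcₛ (≡⇒≡ᵇ cᵣ cᵣ refl)) λ ()
  go (s Vec.∷ rs) (there r∈)  | false = go rs r∈

atRoot-fire-≤ : ∀ {k} (p : Positions k) f ℓ → atRoot (fire p f ℓ) ≤ atRoot (p ℓ)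
atRoot-fire-≤ p f ℓ with fire-cases p f ℓ
... | inj₁ unmoved        = ≤-reflexive (cong atRoot unmoved)
... | inj₂ (_ , _ , moved) = subst (λ v → atRoot v ≤ _) (sym moved) z≤n

atRoot-fire-≥ : ∀ {k} (p : Positions k) f → atRoot (vertex f) ≡ 0 →
  (∀ r → p (Vec.lookup (chips f) r) ≡ vertex f) → ∀ ℓ → atRoot (p ℓ) ≤ atRoot (fire p f ℓ)
atRoot-fire-≥ p f off chosen ℓ with fire-cases p f ℓ
... | inj₁ unmoved        = ≤-reflexive (cong atRoot (sym unmoved))
... | inj₂ (r , refl , _) = ≤-trans (≤-reflexive (trans (cong atRoot (chosen r)) off)) z≤n

rootCount-fire-≤ : ∀ {k} (p : Positions k) f M → rootCount (fire p f) M ≤ rootCount p M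
rootCount-fire-≤ p f M = sumTo-mono-≤ M (λ ℓ _ → atRoot-fire-≤ p f ℓ)

rootCount-fire-≥ : ∀ {k} (p : Positions k) f → atRoot (vertex f) ≡ 0 →
  (∀ r → p (Vec.lookup (chips f) r) ≡ vertex f) → ∀ M → rootCount p M ≤ rootCount (fire p f) M
rootCount-fire-≥ p f off chosen M = sumTo-mono-≤ M (λ ℓ _ → atRoot-fire-≥ p f off chosen ℓ)

rootCount-≤-fire : ∀ {k} (p : Positions k) f M → rootCount p M ≤ k + rootCount (fire p f) M
rootCount-≤-fire {k} p f M = go (allFin k)
  where
  go : ∀ {m} (rs : Vec (Fin k) m) → rootCount p M ≤ m + rootCount (fireAlong p f rs) M
  go Vec.[]       = ≤-refl
  go (r Vec.∷ rs) = ≤-trans (go rs)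
    (≤-trans (+-monoʳ-≤ _ (rootCount-≤-setAt _ _ _ M)) (≤-reflexive (+-suc _ _)))

rootCount-rootFiring : ∀ {k} (p : Positions k) f →
  let c = Vec.lookup (chips f) in
  (∀ r s → toℕ r < toℕ s → c r < c s) → (∀ r → 1 ≤ c r) → (∀ r → p (c r) ≡ []) →
  ∀ M j → c j ≤ M → suc (toℕ j) + rootCount (fire p f) M ≤ rootCount p M
rootCount-rootFiring p f c↑ c≥1 onRoot =
  sumTo-gap (Vec.lookup (chips f)) c↑ c≥1 (atRoot-fire-≤ p f) leaves
  where
  leaves : ∀ r → atRoot (fire p f (Vec.lookup (chips f) r)) < atRoot (p (Vec.lookup (chips f) r))
  leaves r with fire-chosen p f r
  ... | _ , moved = subst₂ _<_ (cong atRoot (sym moved)) (cong atRoot (sym (onRoot r))) (s≤s z≤n)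

rootCount-≤-run : ∀ {k n} (j : Fin k) M (p : Positions k) fs → LegalSeq k n p fs →
  rootCount p M ≤ k * length (arrivals j fs) + rootCount (run p fs) M
rootCount-≤-run j M p [] _ = m≤n+m _ _
rootCount-≤-run {k} j M p (f@(firing [] _) ∷ fs) (_ , legal) = begin
  rootCount p M
    ≤⟨ rootCount-≤-fire p f M ⟩
  k + rootCount (fire p f) M
    ≤⟨ +-monoʳ-≤ k (rootCount-≤-run j M (fire p f) fs legal) ⟩
  k + (k * length (arrivals j fs) + rootCount (run p (f ∷ fs)) M)
    ≡⟨ sym (+-assoc k _ _) ⟩
  k + k * length (arrivals j fs) + rootCount (run p (f ∷ fs)) M
    ≡⟨ cong (_+ rootCount (run p (f ∷ fs)) M) (sym (*-suc k _)) ⟩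
  k * length (arrivals j (f ∷ fs)) + rootCount (run p (f ∷ fs)) M ∎
  where open ≤-Reasoning
rootCount-≤-run j M p (f@(firing (_ ∷ _) _) ∷ fs) ((_ , _ , _ , atVertex) , legal) =
  ≤-trans (rootCount-fire-≥ p f refl atVertex M) (rootCount-≤-run j M (fire p f) fs legal)

countAtMost : ℕ → List ℕ → ℕ
countAtMost M xs = length (filter (_≤? M) xs)

rootCount-≥-run : ∀ {k n} (j : Fin k) M (p : Positions k) fs → LegalSeq k n p fs →
  suc (toℕ j) * countAtMost M (arrivals j fs) + rootCount (run p fs) M ≤ rootCount p M
rootCount-≥-run j M p [] _ = ≤-reflexive (cong (_+ rootCount p M) (*-zeroʳ (suc (toℕ j))))
rootCount-≥-run j M p (f@(firing [] cs) ∷ fs) ((c↑ , c≥1 , _ , onRoot) , legal)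
  with Vec.lookup cs j ≤? M
... | yes cⱼ≤M = begin
  suc t * countAtMost M (arrivals j (f ∷ fs)) + rootCount (run p (f ∷ fs)) M
    ≡⟨ cong (λ c → suc t * length c + rootCount (run p (f ∷ fs)) M) (filter-accept (_≤? M) cⱼ≤M) ⟩
  suc t * suc (countAtMost M (arrivals j fs)) + rootCount (run p (f ∷ fs)) M
    ≡⟨ cong (_+ rootCount (run p (f ∷ fs)) M) (*-suc (suc t) _) ⟩
  suc t + suc t * countAtMost M (arrivals j fs) + rootCount (run p (f ∷ fs)) M
    ≡⟨ +-assoc (suc t) _ _ ⟩
  suc t + (suc t * countAtMost M (arrivals j fs) + rootCount (run (fire p f) fs) M)
    ≤⟨ +-monoʳ-≤ (suc t) (rootCount-≥-run j M (fire p f) fs legal) ⟩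
  suc t + rootCount (fire p f) M
    ≤⟨ rootCount-rootFiring p f c↑ c≥1 onRoot M j cⱼ≤M ⟩
  rootCount p M ∎
  where
  open ≤-Reasoning
  t : ℕ
  t = toℕ j
... | no cⱼ≰M =
  subst (λ c → suc (toℕ j) * c + rootCount (run p (f ∷ fs)) M ≤ rootCount p M)
    (sym (cong length (filter-reject (_≤? M) cⱼ≰M)))
    (≤-trans (rootCount-≥-run j M (fire p f) fs legal) (rootCount-fire-≤ p f M))
rootCount-≥-run j M p (f@(firing (_ ∷ _) _) ∷ fs) (_ , legal) =
  ≤-trans (rootCount-≥-run j M (fire p f) fs legal) (rootCount-fire-≤ p f M)

length-arrivals-≥ : ∀ {k n} (fs : List (Firing k)) → LegalSeq k (suc n) initPos fs →
  Stable k (suc n) (run initPos fs) → (j : Fin k) → k ^ n ≤ length (arrivals j fs)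
length-arrivals-≥ {k} {n} fs legal stable j = s≤s⁻¹ (*-cancelˡ-< k (k ^ n) (suc R) (begin-strict
  k * k ^ n                                      ≡⟨ sym (rootCount-initPos {k} (k ^ suc n)) ⟩
  rootCount (initPos {k}) (k ^ suc n)            ≤⟨ rootCount-≤-run j (k ^ suc n) initPos fs legal ⟩
  k * R + rootCount (run initPos fs) (k ^ suc n) <⟨ +-monoʳ-< (k * R) (rootCount-stable {n = suc n} stable) ⟩
  k * R + k                                      ≡⟨ +-comm (k * R) k ⟩
  k + k * R                                      ≡⟨ sym (*-suc k R) ⟩
  k * suc R                                      ∎))
  where
  open ≤-Reasoning
  R : ℕ
  R = length (arrivals j fs)

countAtMost-lookup-sorted : ∀ {M s} → Sorted s → (i : Fin (length s)) → lookup s i ≤ M →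
  suc (toℕ i) ≤ countAtMost M s
countAtMost-lookup-sorted {M} {a ∷ s} s↗ i sᵢ≤M =
  subst (suc (toℕ i) ≤_) (sym (cong length (filter-accept (_≤? M) a≤M))) (s≤s (inTail i sᵢ≤M))
  where
  a≤M : a ≤ M
  a≤M = ≤-trans (lookup-mono-≤ ≤-totalOrder s↗ {Fin.zero} {i} z≤n) sᵢ≤M
  inTail : ∀ i → lookup (a ∷ s) i ≤ M → toℕ i ≤ countAtMost M s
  inTail Fin.zero    _    = z≤n
  inTail (Fin.suc i) sᵢ≤M = countAtMost-lookup-sorted (Linked.tail s↗) i sᵢ≤M

landing-≥ : ∀ {k n} (fs : List (Firing k)) → LegalSeq k n initPos fs → (j : Fin k) (x : ℕ)
  (x<len : x < length (landing j fs)) → suc (toℕ j) * suc x ≤ lookup (landing j fs) (fromℕ< x<len)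
-- suc (toℕ j) * suc x reduces to suc M, so the chain below reads suc M ≤ M.
landing-≥ {k} fs legal j x x<len = ≮⇒≥ λ c<B → 1+n≰n (begin
  suc (toℕ j) * suc x                         ≤⟨ *-monoʳ-≤ (suc (toℕ j)) (enough (<⇒≤pred c<B)) ⟩
  suc (toℕ j) * countAtMost M (arrivals j fs) ≤⟨ m+n≤o⇒m≤o _ (rootCount-≥-run j M initPos fs legal) ⟩
  rootCount (initPos {k}) M                   ≡⟨ rootCount-initPos {k} M ⟩
  M                                           ∎)
  where
  open ≤-Reasoning
  M : ℕ
  M = pred (suc (toℕ j) * suc x)
  enough : lookup (landing j fs) (fromℕ< x<len) ≤ M → suc x ≤ countAtMost M (arrivals j fs)
  enough c≤M = subst₂ _≤_ (cong suc (Fin.toℕ-fromℕ< x<len))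
    (↭-length (filter-↭ (_≤? M) (sort-↭ (arrivals j fs))))
    (countAtMost-lookup-sorted (sort-↗ (arrivals j fs)) (fromℕ< x<len) c≤M)

corollary4p3 : (k n : ℕ) → 2 ≤ k → 1 ≤ n →
    (fs : List (Firing k)) → LegalSeq k n initPos fs → Stable k n (run initPos fs) →
    (j : Fin k) (x : ℕ) → 1 ≤ x → x ≤ k ^ (n ∸ 1) →
    Σ (x ∸ 1 < length (landing j fs))
      (λ p → (toℕ j + 1) * x ≤ lookup (landing j fs) (fromℕ< p))
corollary4p3 k zero    _ ()
corollary4p3 k (suc n) _ _ fs legal stable j zero    ()
corollary4p3 k (suc n) _ _ fs legal stable j (suc x) _ x<kⁿ =
  x<len , subst (_≤ lookup (landing j fs) (fromℕ< x<len)) (cong (_* suc x) (+-comm 1 (toℕ j)))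
            (landing-≥ fs legal j x x<len)
  where
  x<len : x < length (landing j fs)
  x<len = ≤-trans x<kⁿ (≤-trans (length-arrivals-≥ fs legal stable j)
            (≤-reflexive (sym (↭-length (sort-↭ (arrivals j fs))))))
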